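{- For all integers $p,q,p',q'\geq 2$ with $p\leq p'$ and $q<q'$, there is no contraction model of the complete bipartite graph $K_{p,q}$ in $K_{p',q'}$.
   Context: Graphs are finite, simple, undirected. A contraction model of a graph $H$ in a graph $G$ is a map $\varphi\colon V(H)\to 2^{V(G)}$ such that: (i) each $\varphi(v)$ induces a connected subgraph of $G$; (ii) $\{\varphi(v): v\in V(H)\}$ is a partition of $V(G)$ (into nonempty sets); (iii) for all $u,v\in V(H)$, $u$ and $v$ are adjacent in $H$ iff some vertex of $\varphi(u)$ is adjacent in $G$ to some vertex of $\varphi(v)$. (A graph $H$ is a contraction of $G$ iff such a model exists.) -}

module Defs where

open import Data.Nat using (ℕ; _+_; _<_; _≤_)
open import Data.Nat.Properties using (<⇒≱)
open import Data.Fin using (Fin; toℕ)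
open import Data.Product using (Σ; ∃; _×_; _,_)
open import Data.Sum using (_⊎_; inj₁; inj₂)
open import Data.Empty using (⊥)
open import Relation.Nullary using (¬_)
open import Relation.Binary.PropositionalEquality using (_≡_; _≢_)

record Graph : Set₁ where
  field
    n     : ℕ
    _~_   : Fin n → Fin n → Set
    sym   : ∀ {x y} → x ~ y → y ~ x
    irrefl : ∀ {x} → ¬ (x ~ x)

open Graph public

V : Graph → Set
V G = Fin (n G)

-- Complete bipartite graph K_{p,q}: vertices 0..p-1 form one side,
-- p..p+q-1 the other; x ~ y iff they lie on different sides.
KAdj : (p q : ℕ) → Fin (p + q) → Fin (p + q) → Set
KAdj p q x y = (toℕ x < p × p ≤ toℕ y) ⊎ (p ≤ toℕ x × toℕ y < p)

K : ℕ → ℕ → Graph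
K p q = record
  { n = p + q
  ; _~_ = KAdj p q
  ; sym = λ { (inj₁ (a , b)) → inj₂ (b , a) ; (inj₂ (a , b)) → inj₁ (b , a) }
  ; irrefl = λ { (inj₁ (a , b)) → <⇒≱ a b ; (inj₂ (a , b)) → <⇒≱ b a }
  }

VSet : Graph → Set₁
VSet G = V G → Set

data PathIn (G : Graph) (S : VSet G) : V G → V G → Set where
  here : ∀ {x} → S x → PathIn G S x x
  step : ∀ {x z y} → S x → _~_ G x z → PathIn G S z y → PathIn G S x y

InducesConnected : (G : Graph) → VSet G → Set
InducesConnected G S = ∀ x y → S x → S y → PathIn G S x y

record ContractionModel (H G : Graph) : Set₁ where
  field
    φ : V H → VSet G
    connected : ∀ v → InducesConnected G (φ v)
    nonempty  : ∀ v → ∃ λ x → φ v x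
    covers    : ∀ x → ∃ λ v → φ v x
    disjoint  : ∀ x u v → φ u x → φ v x → u ≡ v
    adj→ : ∀ u v → u ≢ v → _~_ H u v →
             ∃ λ x → ∃ λ y → φ u x × φ v y × _~_ G x y
    adj← : ∀ u v → u ≢ v → (∃ λ x → ∃ λ y → φ u x × φ v y × _~_ G x y) →
             _~_ H u v

-- Since K_{p,q} has fewer vertices than K_{p′,q′}, some branch set φ v contains
-- two vertices, hence (being connected) an edge ab. In a complete bipartite graph
-- every vertex is adjacent to a or to b, so v would be adjacent to every other
-- vertex of K_{p,q}; but for p, q ≥ 2 each vertex has a non-neighbour on its own side.
module Submission where

open import Defs
open import Data.Nat using (ℕ; _≤_; _<_; _+_; s≤s; z≤n; _<?_)
open import Data.Nat.Properties using (<⇒≱; ≮⇒≥; m≤m+n; +-mono-≤-<)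
open import Data.Fin using (Fin; zero; suc; toℕ; _↑ʳ_; _≟_)
open import Data.Fin.Properties using (pigeonhole; toℕ-↑ʳ; ↑ʳ-injective; <⇒≢)
open import Data.Product using (∃; ∃₂; _×_; _,_; proj₁; proj₂)
open import Data.Sum using (_⊎_; inj₁; inj₂)
open import Data.Empty using (⊥-elim)
open import Function using (_∘_)
open import Relation.Nullary using (¬_; yes; no)
open import Relation.Binary.Definitions using (DecidableEquality)
open import Relation.Binary.PropositionalEquality using (_≢_; refl; subst)

avoid-one : {A : Set} {P : A → Set} → DecidableEquality A →
            ∀ {y₀ y₁} → y₀ ≢ y₁ → P y₀ → P y₁ → ∀ x → ∃ λ y → x ≢ y × P y
avoid-one _≟ᴬ_ {y₀} {y₁} y₀≢y₁ Py₀ Py₁ x with x ≟ᴬ y₀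
... | yes refl = y₁ , y₀≢y₁ , Py₁
... | no x≢y₀  = y₀ , x≢y₀ , Py₀

path-start : ∀ {G S x y} → PathIn G S x y → S x
path-start (here Sx)     = Sx
path-start (step Sx _ _) = Sx

path-between-distinct⇒edge : ∀ {G S x y} → PathIn G S x y → x ≢ y →
                             ∃₂ λ a b → S a × S b × _~_ G a b
path-between-distinct⇒edge (here _)           x≢x = ⊥-elim (x≢x refl)
path-between-distinct⇒edge (step Sx x~z rest) _   = _ , _ , Sx , path-start rest , x~z

DominatingEdges : Graph → Set
DominatingEdges G = ∀ {a b} → _~_ G a b → ∀ c → _~_ G a c ⊎ _~_ G b c

HasNonNeighbours : Graph → Set
HasNonNeighbours H = ∀ v → ∃ λ w → v ≢ w × ¬ _~_ H v w

module _ {H G : Graph} (M : ContractionModel H G) where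
  open ContractionModel M

  branch-with-two-vertices : n H < n G → ∃ λ v → ∃₂ λ x y → x ≢ y × φ v x × φ v y
  branch-with-two-vertices nH<nG with pigeonhole nH<nG (λ x → proj₁ (covers x))
  ... | x , y , x<y , branchx≡branchy =
    proj₁ (covers y) , x , y , <⇒≢ x<y
    , subst (λ v → φ v x) branchx≡branchy (proj₂ (covers x)) , proj₂ (covers y)

  adjacent-to-all-others : ∀ {v a b} → φ v a → φ v b → (∀ c → _~_ G a c ⊎ _~_ G b c) →
                           ∀ w → v ≢ w → _~_ H v w
  adjacent-to-all-others {v} {a} {b} φva φvb a-or-b~ w v≢w with nonempty w
  ... | c , φwc with a-or-b~ c
  ... | inj₁ a~c = adj← v w v≢w (a , c , φva , φwc , a~c)
  ... | inj₂ b~c = adj← v w v≢w (b , c , φvb , φwc , b~c)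

no-contraction-model : {H G : Graph} → HasNonNeighbours H → DominatingEdges G →
                       n H < n G → ¬ ContractionModel H G
no-contraction-model non-nbr dominating nH<nG M
  with branch-with-two-vertices M nH<nG
... | v , x , y , x≢y , φvx , φvy
  with path-between-distinct⇒edge (ContractionModel.connected M v x y φvx φvy) x≢y
... | a , b , φva , φvb , a~b
  with non-nbr v
... | w , v≢w , v≁w = v≁w (adjacent-to-all-others M φva φvb (dominating a~b) w v≢w)

K-dominatingEdges : ∀ {p q} → DominatingEdges (K p q)
K-dominatingEdges {p} (inj₁ (a<p , p≤b)) c with toℕ c <? p
... | yes c<p = inj₂ (inj₂ (p≤b , c<p))
... | no  c≮p = inj₁ (inj₁ (a<p , ≮⇒≥ c≮p))
K-dominatingEdges {p} (inj₂ (p≤a , b<p)) c with toℕ c <? p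
... | yes c<p = inj₁ (inj₂ (p≤a , c<p))
... | no  c≮p = inj₂ (inj₁ (b<p , ≮⇒≥ c≮p))

KAdj-left-left : ∀ {p q} {x y : Fin (p + q)} → toℕ x < p → toℕ y < p → ¬ KAdj p q x y
KAdj-left-left _   y<p (inj₁ (_ , p≤y)) = <⇒≱ y<p p≤y
KAdj-left-left x<p _   (inj₂ (p≤x , _)) = <⇒≱ x<p p≤x

KAdj-right-right : ∀ {p q} {x y : Fin (p + q)} → p ≤ toℕ x → p ≤ toℕ y → ¬ KAdj p q x y
KAdj-right-right p≤x _   (inj₁ (x<p , _)) = <⇒≱ x<p p≤x
KAdj-right-right _   p≤y (inj₂ (_ , y<p)) = <⇒≱ y<p p≤y

≤-toℕ-↑ʳ : ∀ p {q} (j : Fin q) → p ≤ toℕ (p ↑ʳ j)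
≤-toℕ-↑ʳ p j rewrite toℕ-↑ʳ p j = m≤m+n p (toℕ j)

K-hasNonNeighbours : ∀ {p q} → 2 ≤ p → 2 ≤ q → HasNonNeighbours (K p q)
K-hasNonNeighbours {p} (s≤s (s≤s _)) (s≤s (s≤s _)) v with toℕ v <? p
... | yes v<p =
  let w , v≢w , w<p = avoid-one {P = λ y → toℕ y < p} _≟_ {zero} {suc zero}
                        (λ ()) (s≤s z≤n) (s≤s (s≤s z≤n)) v
  in w , v≢w , KAdj-left-left v<p w<p
... | no v≮p =
  let w , v≢w , p≤w = avoid-one {P = λ y → p ≤ toℕ y} _≟_ {p ↑ʳ zero} {p ↑ʳ suc zero}
                        ((λ ()) ∘ ↑ʳ-injective p zero (suc zero))
                        (≤-toℕ-↑ʳ p zero) (≤-toℕ-↑ʳ p (suc zero)) v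
  in w , v≢w , KAdj-right-right (≮⇒≥ v≮p) p≤w

lemma1 : (p q p′ q′ : ℕ) → 2 ≤ p → 2 ≤ q → 2 ≤ p′ → 2 ≤ q′ →
         p ≤ p′ → q < q′ → ¬ ContractionModel (K p q) (K p′ q′)
-- Only p + q < p′ + q′ matters.
lemma1 p q p′ q′ 2≤p 2≤q _ _ p≤p′ q<q′ =
  no-contraction-model (K-hasNonNeighbours 2≤p 2≤q) K-dominatingEdges (+-mono-≤-< p≤p′ q<q′)
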